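{- Let $\mathcal O_1,\mathcal O_2$ be $\mathcal{EL}$-ontologies with role inclusions, let $C_1,C_2$ be $\mathcal{EL}$-concepts, and let $\Sigma=\mathrm{sig}(\mathcal O_1,C_1)\cap\mathrm{sig}(\mathcal O_2,C_2)$. Assume that the set of role inclusions in $\mathcal O_1\cup\mathcal O_2$ is safe for $\Sigma$ and that $\mathcal O_1\cup\mathcal O_2\models C_1\sqsubseteq C_2$. Then there exists an $\mathcal{EL}$-concept $D$ with $\mathrm{sig}(D)\subseteq\Sigma$, $\mathcal O_1\cup\mathcal O_2\models C_1\sqsubseteq D$ and $\mathcal O_1\cup\mathcal O_2\models D\sqsubseteq C_2$ (an $\mathcal{EL}$-interpolant for $C_1\sqsubseteq C_2$ under $\mathcal O_1,\mathcal O_2$).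
   Context: $\mathcal{EL}$-concepts: $C ::= \top \mid A \mid C\sqcap C\mid \exists r.C$ with $A$ a concept name and $r$ a role name. An $\mathcal{EL}$-ontology with role inclusions is a finite set of concept inclusions $C\sqsubseteq D$ between $\mathcal{EL}$-concepts and role inclusions $r_1\circ\dots\circ r_n\sqsubseteq r$ ($n\ge 1$, role names), the latter satisfied in $\mathcal I$ if $r_1^{\mathcal I}\circ\dots\circ r_n^{\mathcal I}\subseteq r^{\mathcal I}$. $\mathrm{sig}(X)$ is the set of concept and role names occurring in $X$, and $\mathrm{sig}(\mathcal O,C)=\mathrm{sig}(\mathcal O)\cup\mathrm{sig}(C)$. A set $\mathcal R$ of role inclusions is safe for a signature $\Sigma$ if for every $r_1\circ\dots\circ r_n\sqsubseteq r\in\mathcal R$, whenever $\{r_1,\dots,r_n,r\}\cap\Sigma\neq\emptyset$ then $\{r_1,\dots,r_n,r\}\subseteq\Sigma$. -}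

module Defs where

open import Data.Nat using (ℕ)
open import Data.List using (List; []; _∷_; _++_; concatMap)
open import Data.List.Membership.Propositional using (_∈_)
open import Data.Product using (_×_; ∃-syntax)
open import Level using (Level; suc; _⊔_) renaming (zero to lzero)
open import Data.Unit using (⊤)

ConceptName : Set
ConceptName = ℕ

RoleName : Set
RoleName = ℕ

data Concept : Set where
  top  : Concept
  atom : ConceptName → Concept
  _⊓_  : Concept → Concept → Concept
  ex   : RoleName → Concept → Concept

-- Axioms: concept inclusions C ⊑ D, and role inclusions r₁ ∘ … ∘ rₙ ⊑ r
-- with n ≥ 1 (the chain is given as its first role r₁ and the rest).
data Axiom : Set where
  _⊑_    : Concept → Concept → Axiom
  ri     : RoleName → List RoleName → RoleName → Axiom

Ontology : Set
Ontology = List Axiom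

data Symbol : Set where
  cn : ConceptName → Symbol
  rn : RoleName → Symbol

sigC : Concept → List Symbol
sigC top       = []
sigC (atom A)  = cn A ∷ []
sigC (C ⊓ D)   = sigC C ++ sigC D
sigC (ex r C)  = rn r ∷ sigC C

sigAx : Axiom → List Symbol
sigAx (C ⊑ D)    = sigC C ++ sigC D
sigAx (ri r rs s) = rn r ∷ (Data.List.map rn rs ++ rn s ∷ [])

sigO : Ontology → List Symbol
sigO = concatMap sigAx

sigOC : Ontology → Concept → List Symbol
sigOC O C = sigO O ++ sigC C

SharedSig : Ontology → Concept → Ontology → Concept → Symbol → Set
SharedSig O₁ C₁ O₂ C₂ s = (s ∈ sigOC O₁ C₁) × (s ∈ sigOC O₂ C₂)

SigSubset : Concept → (Symbol → Set) → Set
SigSubset D Σ = ∀ s → s ∈ sigC D → Σ s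

riRoles : RoleName → List RoleName → RoleName → List RoleName
riRoles r rs s = r ∷ (rs ++ s ∷ [])

Safe : Ontology → (Symbol → Set) → Set
Safe O Σ = ∀ r rs s → ri r rs s ∈ O →
  (∃[ t ] (t ∈ riRoles r rs s × Σ (rn t))) →
  ∀ t → t ∈ riRoles r rs s → Σ (rn t)

record Interpretation : Set₁ where
  field
    Δ     : Set
    point : Δ
    conI  : ConceptName → Δ → Set
    roleI : RoleName → Δ → Δ → Set

module _ (I : Interpretation) where
  open Interpretation I

  ext : Concept → Δ → Set
  ext top      x = ⊤
  ext (atom A) x = conI A x
  ext (C ⊓ D)  x = ext C x × ext D x
  ext (ex r C) x = ∃[ y ] (roleI r x y × ext C y)

  chain : RoleName → List RoleName → Δ → Δ → Set
  chain r []        x y = roleI r x y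
  chain r (r' ∷ rs) x y = ∃[ z ] (roleI r x z × chain r' rs z y)

  satAx : Axiom → Set
  satAx (C ⊑ D)     = ∀ x → ext C x → ext D x
  satAx (ri r rs s) = ∀ x y → chain r rs x y → roleI s x y

  Model : Ontology → Set
  Model O = ∀ α → α ∈ O → satAx α

_⊨_⊑_ : Ontology → Concept → Concept → Set₁
O ⊨ C ⊑ D = ∀ (I : Interpretation) → Model I O →
  ∀ x → ext I C x → ext I D x

{-# OPTIONS --safe #-}
-- Build a canonical model M of O₁ ∪ O₂ from two copies of the concepts, with ⊢ a
-- sound derivation calculus.  A copy-2 element y lies exactly in the concepts that y
-- derives.  A copy-1 element x is x seen from the O₁ side: it lies in an atom A when
-- some concept over sig(O₁,C₁) ∩ (sig(O₂,C₂) ∪ {A}) sits between x and A, and it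
-- reaches copy 2 only through a derivable Σ-concept.  Then x ∈ C^M yields a concept
-- over sig(O₁,C₁) ∩ (sig(O₂,C₂) ∪ sig C) between x and C, and M is a model:
-- O₁-axioms only mention O₁-symbols, O₂-axioms pass through Σ, and safety keeps each
-- role chain on one side.  As C₁ ∈ C₁^M ⊆ C₂^M, the concept obtained for C₂ is an
-- interpolant.
module Submission where

open import Defs
open import Data.List using (List; []; _∷_; _++_)
open import Data.List.Membership.Propositional using (_∈_)
open import Data.List.Membership.Propositional.Properties using (∈-++⁺ˡ; ∈-++⁺ʳ; ∈-++⁻)
open import Data.List.Relation.Unary.Any using (here; there)
open import Data.Product using (_×_; ∃-syntax; _,_; proj₁; proj₂)
open import Data.Sum using (_⊎_; inj₁; inj₂; [_,_]′)
open import Data.Unit using (tt)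
open import Data.Empty using (⊥; ⊥-elim)
open import Function using (id)
open import Relation.Nullary using (¬_)
open import Relation.Binary.PropositionalEquality using (refl)

module Derivation (O : Ontology) where

  infix 4 _⊢_

  mutual
    data _⊢_ : Concept → Concept → Set where
      ⊢-refl  : ∀ {C} → C ⊢ C
      ⊢-trans : ∀ {C D E} → C ⊢ D → D ⊢ E → C ⊢ E
      ⊢-top   : ∀ {C} → C ⊢ top
      ⊢-⊓ˡ    : ∀ {C D} → C ⊓ D ⊢ C
      ⊢-⊓ʳ    : ∀ {C D} → C ⊓ D ⊢ D
      ⊢-⊓     : ∀ {C D E} → C ⊢ D → C ⊢ E → C ⊢ D ⊓ E
      ⊢-ex    : ∀ {r C D} → C ⊢ D → ex r C ⊢ ex r D
      ⊢-axiom : ∀ {C D} → (C ⊑ D) ∈ O → C ⊢ D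
      ⊢-ri    : ∀ {r rs s C D} → ri r rs s ∈ O → Chain r rs C D → C ⊢ ex s D

    data Chain : RoleName → List RoleName → Concept → Concept → Set where
      last : ∀ {r C D} → C ⊢ ex r D → Chain r [] C D
      step : ∀ {r r' rs C E D} → C ⊢ ex r E → Chain r' rs E D → Chain r (r' ∷ rs) C D

  mutual
    sound : ∀ {C D} → C ⊢ D → O ⊨ C ⊑ D
    sound ⊢-refl        I M x e = e
    sound (⊢-trans p q) I M x e = sound q I M x (sound p I M x e)
    sound ⊢-top         I M x e = tt
    sound ⊢-⊓ˡ          I M x e = proj₁ e
    sound ⊢-⊓ʳ          I M x e = proj₂ e
    sound (⊢-⊓ p q)     I M x e = sound p I M x e , sound q I M x e
    sound (⊢-ex p)      I M x (y , xy , e) = y , xy , sound p I M y e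
    sound (⊢-axiom α)   I M x e = M _ α x e
    sound (⊢-ri α ch)   I M x e with sound-chain ch I M x e
    ... | y , xy , ey = y , M _ α x y xy , ey

    sound-chain : ∀ {r rs C D} → Chain r rs C D → ∀ I → Model I O → ∀ x → ext I C x →
                  ∃[ y ] (chain I r rs x y × ext I D y)
    sound-chain (last p) I M x e = sound p I M x e
    sound-chain (step p ch) I M x e with sound p I M x e
    ... | z , xz , ez with sound-chain ch I M z ez
    ... | y , zy , ey = y , (z , xz , zy) , ey

module _ (C D : Concept) {P : Symbol → Set} where

  SigSubset-⊓ : SigSubset C P → SigSubset D P → SigSubset (C ⊓ D) P
  SigSubset-⊓ σ τ s m = [ σ s , τ s ]′ (∈-++⁻ (sigC C) m)

  SigSubset-⊓ˡ : SigSubset (C ⊓ D) P → SigSubset C P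
  SigSubset-⊓ˡ σ s m = σ s (∈-++⁺ˡ m)

  SigSubset-⊓ʳ : SigSubset (C ⊓ D) P → SigSubset D P
  SigSubset-⊓ʳ σ s m = σ s (∈-++⁺ʳ (sigC C) m)

module _ (r : RoleName) (C : Concept) {P : Symbol → Set} where

  SigSubset-ex : P (rn r) → SigSubset C P → SigSubset (ex r C) P
  SigSubset-ex p σ s (here refl) = p
  SigSubset-ex p σ s (there m)   = σ s m

  SigSubset-ex⁻ : SigSubset (ex r C) P → P (rn r) × SigSubset C P
  SigSubset-ex⁻ σ = σ (rn r) (here refl) , λ s m → σ s (there m)

SigSubset-mono : ∀ C {P Q : Symbol → Set} → (∀ {s} → P s → Q s) →
                 SigSubset C P → SigSubset C Q
SigSubset-mono C f σ s m = f (σ s m)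

sigAx⊆sigO : ∀ {α O s} → α ∈ O → s ∈ sigAx α → s ∈ sigO O
sigAx⊆sigO {O = β ∷ O} (here refl) m = ∈-++⁺ˡ m
sigAx⊆sigO {O = β ∷ O} (there α) m   = ∈-++⁺ʳ (sigAx β) (sigAx⊆sigO α m)

riRoles⊆sigAx : ∀ r rs s {t} → t ∈ riRoles r rs s → rn t ∈ sigAx (ri r rs s)
riRoles⊆sigAx r rs       s (here refl) = here refl
riRoles⊆sigAx r []       s (there (here refl)) = there (here refl)
riRoles⊆sigAx r (r' ∷ rs) s (there m) = there (riRoles⊆sigAx r' rs s m)

chainRoles⊆riRoles : ∀ {r rs s t} → t ∈ r ∷ rs → t ∈ riRoles r rs s
chainRoles⊆riRoles (here refl) = here refl
chainRoles⊆riRoles (there m)   = there (∈-++⁺ˡ m)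

target∈riRoles : ∀ r rs s → s ∈ riRoles r rs s
target∈riRoles r rs s = there (∈-++⁺ʳ rs (here refl))

module CanonicalModel (O₁ O₂ : Ontology) (C₁ C₂ : Concept) where

  O : Ontology
  O = O₁ ++ O₂
  open Derivation O

  Sig₁ Sig₂ Σ : Symbol → Set
  Sig₁ s = s ∈ sigOC O₁ C₁
  Sig₂ s = s ∈ sigOC O₂ C₂
  Σ      = SharedSig O₁ C₁ O₂ C₂

  Sig₁-of-O₁ : ∀ {α s} → α ∈ O₁ → s ∈ sigAx α → Sig₁ s
  Sig₁-of-O₁ α m = ∈-++⁺ˡ (sigAx⊆sigO α m)

  Sig₂-of-O₂ : ∀ {α s} → α ∈ O₂ → s ∈ sigAx α → Sig₂ s
  Sig₂-of-O₂ α m = ∈-++⁺ˡ (sigAx⊆sigO α m)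

  Sig₁-of-C₁ : SigSubset C₁ Sig₁
  Sig₁-of-C₁ s m = ∈-++⁺ʳ (sigO O₁) m

  Sig₂-of-C₂ : SigSubset C₂ Sig₂
  Sig₂-of-C₂ s m = ∈-++⁺ʳ (sigO O₂) m

  -- Between x C is the invariant carried by copy 1: an interpolant from x to C that
  -- may still use symbols of C outside sig(O₂,C₂).
  Local : Concept → Symbol → Set
  Local C s = Sig₁ s × (Sig₂ s ⊎ s ∈ sigC C)

  Between : Concept → Concept → Set
  Between x C = ∃[ D ] (SigSubset D (Local C) × x ⊢ D × D ⊢ C)

  ΣBetween : Concept → Concept → Set
  ΣBetween x C = ∃[ D ] (SigSubset D Σ × x ⊢ D × D ⊢ C)

  Local-mono : ∀ C C' → (∀ {s} → s ∈ sigC C → s ∈ sigC C') → ∀ {s} → Local C s → Local C' s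
  Local-mono C C' f (s₁ , s₂) = s₁ , [ inj₁ , (λ m → inj₂ (f m)) ]′ s₂

  Σ⇒Local : ∀ C {s} → Σ s → Local C s
  Σ⇒Local C (s₁ , s₂) = s₁ , inj₁ s₂

  Local⇒Σ : ∀ C {s} → SigSubset C Sig₂ → Local C s → Σ s
  Local⇒Σ C τ (s₁ , s₂) = s₁ , [ id , τ _ ]′ s₂

  data Element : Set where
    ⟨_⟩₁ ⟨_⟩₂ : Concept → Element

  concepts : ConceptName → Element → Set
  concepts A ⟨ x ⟩₁ = Between x (atom A)
  concepts A ⟨ y ⟩₂ = y ⊢ atom A

  roles : RoleName → Element → Element → Set
  roles r ⟨ x ⟩₁ ⟨ y ⟩₁ = Sig₁ (rn r) × x ⊢ ex r y
  roles r ⟨ x ⟩₁ ⟨ y ⟩₂ = Sig₂ (rn r) × ΣBetween x (ex r y)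
  roles r ⟨ x ⟩₂ ⟨ y ⟩₁ = ⊥
  roles r ⟨ x ⟩₂ ⟨ y ⟩₂ = x ⊢ ex r y

  M : Interpretation
  M = record { Δ = Element ; point = ⟨ top ⟩₂ ; conI = concepts ; roleI = roles }

  _∈ᴹ_ : Element → Concept → Set
  e ∈ᴹ C = ext M C e

  mutual
    ∈ᴹ₂⇒⊢ : ∀ C y → ⟨ y ⟩₂ ∈ᴹ C → y ⊢ C
    ∈ᴹ₂⇒⊢ top      y e       = ⊢-top
    ∈ᴹ₂⇒⊢ (atom A) y e       = e
    ∈ᴹ₂⇒⊢ (C ⊓ D)  y (e , f) = ⊢-⊓ (∈ᴹ₂⇒⊢ C y e) (∈ᴹ₂⇒⊢ D y f)
    ∈ᴹ₂⇒⊢ (ex r C) y (⟨ z ⟩₁ , () , _)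
    ∈ᴹ₂⇒⊢ (ex r C) y (⟨ z ⟩₂ , p , e) = ⊢-trans p (⊢-ex (∈ᴹ₂⇒⊢ C z e))

    ⊢⇒∈ᴹ₂ : ∀ C y → y ⊢ C → ⟨ y ⟩₂ ∈ᴹ C
    ⊢⇒∈ᴹ₂ top      y p = tt
    ⊢⇒∈ᴹ₂ (atom A) y p = p
    ⊢⇒∈ᴹ₂ (C ⊓ D)  y p = ⊢⇒∈ᴹ₂ C y (⊢-trans p ⊢-⊓ˡ) , ⊢⇒∈ᴹ₂ D y (⊢-trans p ⊢-⊓ʳ)
    ⊢⇒∈ᴹ₂ (ex r C) y p = ⟨ C ⟩₂ , p , ⊢⇒∈ᴹ₂ C C ⊢-refl

  ∈ᴹ₁⇒Between : ∀ C x → ⟨ x ⟩₁ ∈ᴹ C → Between x C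
  ∈ᴹ₁⇒Between top      x e = top , (λ s ()) , ⊢-top , ⊢-refl
  ∈ᴹ₁⇒Between (atom A) x e = e
  ∈ᴹ₁⇒Between (C ⊓ C') x (e , e')
    with ∈ᴹ₁⇒Between C x e | ∈ᴹ₁⇒Between C' x e'
  ... | D , σ , p , q | D' , σ' , p' , q' =
    D ⊓ D' ,
    SigSubset-⊓ D D' (SigSubset-mono D (Local-mono C (C ⊓ C') ∈-++⁺ˡ) σ)
                (SigSubset-mono D' (Local-mono C' (C ⊓ C') (∈-++⁺ʳ (sigC C))) σ') ,
    ⊢-⊓ p p' , ⊢-⊓ (⊢-trans ⊢-⊓ˡ q) (⊢-trans ⊢-⊓ʳ q')
  ∈ᴹ₁⇒Between (ex r C) x (⟨ y ⟩₁ , (r₁ , p) , e) with ∈ᴹ₁⇒Between C y e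
  ... | D , σ , q , q' =
    ex r D , SigSubset-ex r D (r₁ , inj₂ (here refl)) (SigSubset-mono D (Local-mono C (ex r C) there) σ) ,
    ⊢-trans p (⊢-ex q) , ⊢-ex q'
  ∈ᴹ₁⇒Between (ex r C) x (⟨ y ⟩₂ , (_ , D , σ , p , q) , e) =
    D , SigSubset-mono D (Σ⇒Local (ex r C)) σ , p , ⊢-trans q (⊢-ex (∈ᴹ₂⇒⊢ C y e))

  Sig₁-⊢⇒∈ᴹ₁ : ∀ F x → SigSubset F Sig₁ → x ⊢ F → ⟨ x ⟩₁ ∈ᴹ F
  Sig₁-⊢⇒∈ᴹ₁ top      x σ p = tt
  Sig₁-⊢⇒∈ᴹ₁ (atom A) x σ p = atom A , (λ s m → σ s m , inj₂ m) , p , ⊢-refl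
  Sig₁-⊢⇒∈ᴹ₁ (F ⊓ G)  x σ p = Sig₁-⊢⇒∈ᴹ₁ F x (SigSubset-⊓ˡ F G σ) (⊢-trans p ⊢-⊓ˡ) ,
                              Sig₁-⊢⇒∈ᴹ₁ G x (SigSubset-⊓ʳ F G σ) (⊢-trans p ⊢-⊓ʳ)
  Sig₁-⊢⇒∈ᴹ₁ (ex r G) x σ p with SigSubset-ex⁻ r G σ
  ... | r₁ , σ' = ⟨ G ⟩₁ , (r₁ , p) , Sig₁-⊢⇒∈ᴹ₁ G G σ' ⊢-refl

  Sig₂-ΣBetween⇒∈ᴹ₁ : ∀ F x → SigSubset F Sig₂ → ΣBetween x F → ⟨ x ⟩₁ ∈ᴹ F
  Sig₂-ΣBetween⇒∈ᴹ₁ top      x τ b = tt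
  Sig₂-ΣBetween⇒∈ᴹ₁ (atom A) x τ (D , σ , p , q) = D , SigSubset-mono D (Σ⇒Local (atom A)) σ , p , q
  Sig₂-ΣBetween⇒∈ᴹ₁ (F ⊓ G)  x τ (D , σ , p , q) =
    Sig₂-ΣBetween⇒∈ᴹ₁ F x (SigSubset-⊓ˡ F G τ) (D , σ , p , ⊢-trans q ⊢-⊓ˡ) ,
    Sig₂-ΣBetween⇒∈ᴹ₁ G x (SigSubset-⊓ʳ F G τ) (D , σ , p , ⊢-trans q ⊢-⊓ʳ)
  Sig₂-ΣBetween⇒∈ᴹ₁ (ex r G) x τ b = ⟨ G ⟩₂ , (proj₁ (SigSubset-ex⁻ r G τ) , b) , ⊢⇒∈ᴹ₂ G G ⊢-refl

  ¬chain₂₁ : ∀ r rs y z → ¬ chain M r rs ⟨ y ⟩₂ ⟨ z ⟩₁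
  ¬chain₂₁ r []        y z ()
  ¬chain₂₁ r (r' ∷ rs) y z (⟨ w ⟩₁ , () , _)
  ¬chain₂₁ r (r' ∷ rs) y z (⟨ w ⟩₂ , _ , c) = ¬chain₂₁ r' rs w z c

  chain₂₂⇒Chain : ∀ r rs y z → chain M r rs ⟨ y ⟩₂ ⟨ z ⟩₂ → Chain r rs y z
  chain₂₂⇒Chain r []        y z c = last c
  chain₂₂⇒Chain r (r' ∷ rs) y z (⟨ w ⟩₁ , () , _)
  chain₂₂⇒Chain r (r' ∷ rs) y z (⟨ w ⟩₂ , p , c) = step p (chain₂₂⇒Chain r' rs w z c)

  chain₁₁⇒Chain : ∀ r rs x z → chain M r rs ⟨ x ⟩₁ ⟨ z ⟩₁ → Sig₁ (rn r) × Chain r rs x z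
  chain₁₁⇒Chain r []        x z (r₁ , p) = r₁ , last p
  chain₁₁⇒Chain r (r' ∷ rs) x z (⟨ w ⟩₁ , (r₁ , p) , c) = r₁ , step p (proj₂ (chain₁₁⇒Chain r' rs w z c))
  chain₁₁⇒Chain r (r' ∷ rs) x z (⟨ w ⟩₂ , _ , c)        = ⊥-elim (¬chain₂₁ r' rs w z c)

  chain₁₂-meets-Sig₂ : ∀ r rs x z → chain M r rs ⟨ x ⟩₁ ⟨ z ⟩₂ → ∃[ t ] (t ∈ r ∷ rs × Sig₂ (rn t))
  chain₁₂-meets-Sig₂ r []        x z (r₂ , _) = r , here refl , r₂
  chain₁₂-meets-Sig₂ r (r' ∷ rs) x z (⟨ w ⟩₁ , _ , c) with chain₁₂-meets-Sig₂ r' rs w z c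
  ... | t , t∈ , t₂ = t , there t∈ , t₂
  chain₁₂-meets-Sig₂ r (r' ∷ rs) x z (⟨ w ⟩₂ , (r₂ , _) , c) = r , here refl , r₂

  chain₁₂⇒ΣChain : ∀ r rs x z → (∀ t → t ∈ r ∷ rs → Sig₂ (rn t)) → chain M r rs ⟨ x ⟩₁ ⟨ z ⟩₂ →
                   ∃[ E ] (SigSubset E Σ × x ⊢ E × Chain r rs E z)
  chain₁₂⇒ΣChain r []        x z _   (_ , D , σ , p , q) = D , σ , p , last q
  chain₁₂⇒ΣChain r (r' ∷ rs) x z all₂ (⟨ w ⟩₁ , (r₁ , p) , c)
    with chain₁₂⇒ΣChain r' rs w z (λ t m → all₂ t (there m)) c
  ... | E , σ , q , ch =
    ex r E , SigSubset-ex r E (r₁ , all₂ r (here refl)) σ , ⊢-trans p (⊢-ex q) , step ⊢-refl ch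
  chain₁₂⇒ΣChain r (r' ∷ rs) x z _ (⟨ w ⟩₂ , (_ , D , σ , p , q) , c) =
    D , σ , p , step q (chain₂₂⇒Chain r' rs w z c)

  satisfies-⊑ : ∀ {E F} → (E ⊑ F) ∈ O → ∀ x → x ∈ᴹ E → x ∈ᴹ F
  satisfies-⊑ {E} {F} α ⟨ y ⟩₂ e = ⊢⇒∈ᴹ₂ F y (⊢-trans (∈ᴹ₂⇒⊢ E y e) (⊢-axiom α))
  satisfies-⊑ {E} {F} α ⟨ x ⟩₁ e with ∈ᴹ₁⇒Between E x e | ∈-++⁻ O₁ α
  ... | D , σ , p , q | inj₁ α₁ =
    Sig₁-⊢⇒∈ᴹ₁ F x (λ s m → Sig₁-of-O₁ α₁ (∈-++⁺ʳ (sigC E) m)) (⊢-trans p (⊢-trans q (⊢-axiom α)))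
  ... | D , σ , p , q | inj₂ α₂ =
    Sig₂-ΣBetween⇒∈ᴹ₁ F x F₂ (D , SigSubset-mono D (Local⇒Σ E E₂) σ , p , ⊢-trans q (⊢-axiom α))
    where
    E₂ : SigSubset E Sig₂
    E₂ s m = Sig₂-of-O₂ α₂ (∈-++⁺ˡ m)
    F₂ : SigSubset F Sig₂
    F₂ s m = Sig₂-of-O₂ α₂ (∈-++⁺ʳ (sigC E) m)

  module _ (safe : Safe O Σ) where

    ri-Sig₁-closed : ∀ {r rs s t} → ri r rs s ∈ O → t ∈ riRoles r rs s → Sig₁ (rn t) →
                     ∀ u → u ∈ riRoles r rs s → Sig₁ (rn u)
    ri-Sig₁-closed {r} {rs} {s} {t} α t∈ t₁ u u∈ with ∈-++⁻ O₁ α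
    ... | inj₁ α₁ = Sig₁-of-O₁ α₁ (riRoles⊆sigAx r rs s u∈)
    ... | inj₂ α₂ = proj₁ (safe r rs s α (t , t∈ , t₁ , Sig₂-of-O₂ α₂ (riRoles⊆sigAx r rs s t∈)) u u∈)

    ri-Sig₂-closed : ∀ {r rs s t} → ri r rs s ∈ O → t ∈ riRoles r rs s → Sig₂ (rn t) →
                     ∀ u → u ∈ riRoles r rs s → Sig₂ (rn u)
    ri-Sig₂-closed {r} {rs} {s} {t} α t∈ t₂ u u∈ with ∈-++⁻ O₁ α
    ... | inj₁ α₁ = proj₂ (safe r rs s α (t , t∈ , Sig₁-of-O₁ α₁ (riRoles⊆sigAx r rs s t∈) , t₂) u u∈)
    ... | inj₂ α₂ = Sig₂-of-O₂ α₂ (riRoles⊆sigAx r rs s u∈)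

    satisfies-ri : ∀ {r rs s} → ri r rs s ∈ O → ∀ x y → chain M r rs x y → roles s x y
    satisfies-ri {r} {rs} α ⟨ y ⟩₂ ⟨ z ⟩₁ c = ⊥-elim (¬chain₂₁ r rs y z c)
    satisfies-ri {r} {rs} α ⟨ y ⟩₂ ⟨ z ⟩₂ c = ⊢-ri α (chain₂₂⇒Chain r rs y z c)
    satisfies-ri {r} {rs} {s} α ⟨ x ⟩₁ ⟨ z ⟩₁ c with chain₁₁⇒Chain r rs x z c
    ... | r₁ , ch = ri-Sig₁-closed α (here refl) r₁ s (target∈riRoles r rs s) , ⊢-ri α ch
    satisfies-ri {r} {rs} {s} α ⟨ x ⟩₁ ⟨ z ⟩₂ c with chain₁₂-meets-Sig₂ r rs x z c
    ... | t , t∈ , t₂ = through-Σ (ri-Sig₂-closed α (chainRoles⊆riRoles t∈) t₂)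
      where
      through-Σ : (∀ u → u ∈ riRoles r rs s → Sig₂ (rn u)) → roles s ⟨ x ⟩₁ ⟨ z ⟩₂
      through-Σ all₂ with chain₁₂⇒ΣChain r rs x z (λ u m → all₂ u (chainRoles⊆riRoles m)) c
      ... | E , σ , p , ch = all₂ s (target∈riRoles r rs s) , E , σ , p , ⊢-ri α ch

    model : Model M O
    model (E ⊑ F)     α = satisfies-⊑ α
    model (ri r rs s) α = satisfies-ri α

theorem4 : (O₁ O₂ : Ontology) (C₁ C₂ : Concept) →
    Safe (O₁ ++ O₂) (SharedSig O₁ C₁ O₂ C₂) →
    (O₁ ++ O₂) ⊨ C₁ ⊑ C₂ →
    ∃[ D ] (SigSubset D (SharedSig O₁ C₁ O₂ C₂) ×
            ((O₁ ++ O₂) ⊨ C₁ ⊑ D) × ((O₁ ++ O₂) ⊨ D ⊑ C₂))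
theorem4 O₁ O₂ C₁ C₂ safe C₁⊑C₂ =
  let (D , σ , C₁⊢D , D⊢C₂) = between in
  D , SigSubset-mono D (Local⇒Σ C₂ Sig₂-of-C₂) σ , sound C₁⊢D , sound D⊢C₂
  where
  open CanonicalModel O₁ O₂ C₁ C₂
  open Derivation O

  C₁∈ᴹC₁ : ⟨ C₁ ⟩₁ ∈ᴹ C₁
  C₁∈ᴹC₁ = Sig₁-⊢⇒∈ᴹ₁ C₁ C₁ Sig₁-of-C₁ ⊢-refl

  between : Between C₁ C₂
  between = ∈ᴹ₁⇒Between C₂ C₁ (C₁⊑C₂ M (model safe) ⟨ C₁ ⟩₁ C₁∈ᴹC₁)
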